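{- Let $\mathbf{a}=(a_k)_{k\ge0}$ be a sequence of nonnegative real numbers. Then all coefficients of the run transform $\Phi\big(\sum_{k\ge0}a_kx^k\big)$ (a power series in $x,y$) are nonnegative if and only if all entries of the sequence $\mathbf{c}:=\mathbf{a}\,C^{ -1}$ are nonnegative.
   Context: The run transform is $\Phi\big(f(x)\big)=\frac{1-x}{1-xy}\,f\!\left(\frac{x(1-x)}{1-xy}\right)$. The Catalan matrix is $C=\left(\binom{2j-i}{j-i}-\binom{2j-i}{j-i-1}\right)_{i,j\ge0}$ (with $\binom{n}{m}=0$ for $m<0$), an upper triangular matrix with inverse $C^{ -1}=\left((-1)^{j-i}\binom{i+1}{j-i}\right)_{i,j\ge0}$; sequences are row vectors, so $\mathbf{a}\,C^{ -1}$ is a vector–matrix product. -}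

module Defs where

open import Level using (Level; _⊔_)
open import Data.Nat as ℕ using (ℕ; zero; suc; _∸_)
open import Data.Nat.Combinatorics using (_C_)
open import Relation.Binary.Core using (Rel)
open import Relation.Binary.Structures using (IsTotalOrder)
open import Algebra.Bundles using (CommutativeRing)

-- The paper works over ℝ, which is an instance.
record OrderedCommRing (c ℓ₁ ℓ₂ : Level) : Set (Level.suc (c ⊔ ℓ₁ ⊔ ℓ₂)) where
  field
    commutativeRing : CommutativeRing c ℓ₁
  open CommutativeRing commutativeRing public
  field
    _≤_          : Rel Carrier ℓ₂
    isTotalOrder : IsTotalOrder _≈_ _≤_
    +-mono-≤     : ∀ {x y} z → x ≤ y → (x + z) ≤ (y + z)
    *-nonneg     : ∀ {x y} → 0# ≤ x → 0# ≤ y → 0# ≤ (x * y)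

module Series {c ℓ₁ ℓ₂} (R : OrderedCommRing c ℓ₁ ℓ₂) where
  open OrderedCommRing R

  sumTo : ℕ → (ℕ → Carrier) → Carrier
  sumTo zero    f = f 0
  sumTo (suc n) f = sumTo n f + f (suc n)

  natR : ℕ → Carrier
  natR zero    = 0#
  natR (suc n) = 1# + natR n

  signR : ℕ → Carrier
  signR zero    = 1#
  signR (suc n) = - signR n

  Series₁ : Set c
  Series₁ = ℕ → Carrier

  -- Formal power series in x, y:  s n m = [x^n y^m] s.
  Series₂ : Set c
  Series₂ = ℕ → ℕ → Carrier

  _⊛_ : Series₂ → Series₂ → Series₂
  (f ⊛ g) n m = sumTo n (λ i → sumTo m (λ j → f i j * g (n ∸ i) (m ∸ j)))

  oneS : Series₂
  oneS zero zero = 1#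
  oneS _    _    = 0#

  _^S_ : Series₂ → ℕ → Series₂
  f ^S zero  = oneS
  f ^S suc k = f ⊛ (f ^S k)

  xS : Series₂
  xS (suc zero) zero = 1#
  xS _          _    = 0#

  oneMinusX : Series₂
  oneMinusX zero       zero = 1#
  oneMinusX (suc zero) zero = - 1#
  oneMinusX _          _    = 0#

  geomXY : Series₂
  geomXY zero    zero    = 1#
  geomXY zero    (suc _) = 0#
  geomXY (suc _) zero    = 0#
  geomXY (suc n) (suc m) = geomXY n m

  prefactor : Series₂
  prefactor = oneMinusX ⊛ geomXY

  inner : Series₂
  inner = xS ⊛ prefactor

  -- Substitution f(g) for g with every term of x-degree ≥ 1:
  -- [x^n y^m] Σ_k a_k g^k = Σ_{k=0}^{n} a_k [x^n y^m] g^k,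
  -- multiplied by the prefactor.
  Φ : Series₁ → Series₂
  Φ a = prefactor ⊛ (λ n m → sumTo n (λ k → a k * (inner ^S k) n m))

  -- Entries of C⁻¹ : (C⁻¹)_{ij} = (-1)^{j-i} binom(i+1, j-i) (zero for i > j)
  -- c = a C⁻¹ (row vector times matrix), c_j = Σ_{i=0}^{j} a_i (C⁻¹)_{ij}
  catInv : Series₁ → Series₁
  catInv a j = sumTo j (λ i → a i * (signR (j ∸ i) * natR (suc i C (j ∸ i))))

module Submission where

-- Let G = 1/(1 - xy), so that the run transform is Φ(a) = P·a(I) with P = (1 - x)G and I = xP.
-- There is a series V with nonnegative coefficients and V(x,0) = 1 such that P = V(1 - W) for
-- W = xV: writing V = G + D this amounts to D = x(xyG² + 2GD + D²), whose unique solution is the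
-- limit of its iterates starting from 0.  Then I = W(1 - W), and c = aC⁻¹ is exactly the relation
-- (1 - W)·a(I) = c(W) (the Catalan inversion).  Hence Φ(a) = V·c(W): if c ≥ 0 all coefficients of
-- Φ(a) are nonnegative, and at y = 0, where V = 1 and W = x, Φ(a) reduces to c.

open import Defs
open import Data.Nat using (ℕ)
open import Function.Bundles using (_⇔_; mk⇔)

open import Data.Nat as ℕ using (zero; suc; _∸_; _⊓_; z≤n; s≤s)
import Data.Nat.Properties as ℕₚ
open import Data.Nat.Combinatorics using (_C_; nCk+nC[k+1]≡[n+1]C[k+1])
open import Data.Sum using (inj₁; inj₂)
open import Function using (_∘_)
open import Data.Product using (_,_)
open import Algebra.Bundles using (CommutativeRing)
open import Relation.Binary.PropositionalEquality as ≡ using (_≡_)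
import Relation.Binary.Reasoning.Setoid as SetoidReasoning

[n∸i]∸[k∸i]≡n∸k : ∀ n {i k} → i ℕ.≤ k → (n ∸ i) ∸ (k ∸ i) ≡ n ∸ k
[n∸i]∸[k∸i]≡n∸k n {i} {k} i≤k = ≡.trans (ℕₚ.∸-+-assoc n i (k ∸ i)) (≡.cong (n ∸_) (ℕₚ.m+[n∸m]≡n i≤k))

module FiniteSum {c ℓ} (A : CommutativeRing c ℓ) where
  open CommutativeRing A
  open SetoidReasoning setoid
  open import Algebra.Properties.CommutativeSemigroup +-commutativeSemigroup
    using (interchange)

  ∑ : ℕ → (ℕ → Carrier) → Carrier
  ∑ zero    f = f 0
  ∑ (suc n) f = ∑ n f + f (suc n)

  ∑-cong : ∀ n {f g} → (∀ i → i ℕ.≤ n → f i ≈ g i) → ∑ n f ≈ ∑ n g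
  ∑-cong zero    f≈g = f≈g 0 z≤n
  ∑-cong (suc n) f≈g = +-cong (∑-cong n (λ i i≤n → f≈g i (ℕₚ.m≤n⇒m≤1+n i≤n))) (f≈g (suc n) ℕₚ.≤-refl)

  ∑-zero : ∀ n {f} → (∀ i → i ℕ.≤ n → f i ≈ 0#) → ∑ n f ≈ 0#
  ∑-zero n f≈0 = trans (∑-cong n f≈0) (∑-const n)
    where
    ∑-const : ∀ n → ∑ n (λ _ → 0#) ≈ 0#
    ∑-const zero    = refl
    ∑-const (suc n) = trans (+-congʳ (∑-const n)) (+-identityʳ 0#)

  ∑-distrib-+ : ∀ n (f g : ℕ → Carrier) → ∑ n (λ i → f i + g i) ≈ ∑ n f + ∑ n g
  ∑-distrib-+ zero    f g = refl
  ∑-distrib-+ (suc n) f g = trans (+-congʳ (∑-distrib-+ n f g)) (interchange _ _ _ _)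

  *-distribˡ-∑ : ∀ n x (f : ℕ → Carrier) → x * ∑ n f ≈ ∑ n (λ i → x * f i)
  *-distribˡ-∑ zero    x f = refl
  *-distribˡ-∑ (suc n) x f = trans (distribˡ x _ _) (+-congʳ (*-distribˡ-∑ n x f))

  *-distribʳ-∑ : ∀ n x (f : ℕ → Carrier) → ∑ n f * x ≈ ∑ n (λ i → f i * x)
  *-distribʳ-∑ zero    x f = refl
  *-distribʳ-∑ (suc n) x f = trans (distribʳ x _ _) (+-congʳ (*-distribʳ-∑ n x f))

  ∑-unfoldˡ : ∀ n (f : ℕ → Carrier) → ∑ (suc n) f ≈ f 0 + ∑ n (f ∘ suc)
  ∑-unfoldˡ zero    f = refl
  ∑-unfoldˡ (suc n) f = trans (+-congʳ (∑-unfoldˡ n f)) (+-assoc _ _ _)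

  ∑-head : ∀ n (f : ℕ → Carrier) → (∀ i → f (suc i) ≈ 0#) → ∑ n f ≈ f 0
  ∑-head zero    f f≈0 = refl
  ∑-head (suc n) f f≈0 = trans (+-cong (∑-head n f f≈0) (f≈0 n)) (+-identityʳ _)

  ∑-extend : ∀ {n} N (f : ℕ → Carrier) → n ℕ.≤ N → (∀ k → n ℕ.< k → f k ≈ 0#) → ∑ N f ≈ ∑ n f
  ∑-extend zero    f z≤n    f≈0 = refl
  ∑-extend (suc N) f n≤1+N f≈0 with ℕₚ.m≤n⇒m<n∨m≡n n≤1+N
  ... | inj₂ ≡.refl      = refl
  ... | inj₁ (s≤s n≤N) = trans (+-cong (∑-extend N f n≤N f≈0) (f≈0 (suc N) (s≤s n≤N))) (+-identityʳ _)

  ∑-reverse : ∀ n (f : ℕ → Carrier) → ∑ n f ≈ ∑ n (λ i → f (n ∸ i))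
  ∑-reverse zero    f = refl
  ∑-reverse (suc n) f = begin
    ∑ (suc n) f                                 ≈⟨ ∑-unfoldˡ n f ⟩
    f 0 + ∑ n (f ∘ suc)                         ≈⟨ +-comm _ _ ⟩
    ∑ n (f ∘ suc) + f 0
      ≈⟨ +-cong (∑-reverse n (f ∘ suc)) (reflexive (≡.cong f (≡.sym (ℕₚ.n∸n≡0 n)))) ⟩
    ∑ n (λ i → f (suc (n ∸ i))) + f (n ∸ n)
      ≈⟨ +-congʳ (∑-cong n (λ i i≤n → reflexive (≡.cong f (≡.sym (ℕₚ.+-∸-assoc 1 i≤n))))) ⟩
    ∑ (suc n) (λ i → f (suc n ∸ i))             ∎

  ∑-comm : ∀ n m (F : ℕ → ℕ → Carrier) → ∑ n (λ i → ∑ m (F i)) ≈ ∑ m (λ j → ∑ n (λ i → F i j))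
  ∑-comm zero    m F = refl
  ∑-comm (suc n) m F = trans (+-congʳ (∑-comm n m F)) (sym (∑-distrib-+ m _ _))

  ∑-triangle : ∀ n (F : ℕ → ℕ → Carrier) →
               ∑ n (λ i → ∑ (n ∸ i) (F i)) ≈ ∑ n (λ k → ∑ k (λ i → F i (k ∸ i)))
  ∑-triangle zero    F = refl
  ∑-triangle (suc n) F = begin
    ∑ n (λ i → ∑ (suc n ∸ i) (F i)) + ∑ (n ∸ n) (F (suc n))
      ≈⟨ +-cong (∑-cong n (λ i i≤n → reflexive (≡.cong (λ k → ∑ k (F i)) (ℕₚ.+-∸-assoc 1 i≤n))))
                (reflexive (≡.cong (λ k → ∑ k (F (suc n))) (ℕₚ.n∸n≡0 n))) ⟩
    ∑ n (λ i → ∑ (n ∸ i) (F i) + F i (suc (n ∸ i))) + F (suc n) 0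
      ≈⟨ trans (+-congʳ (∑-distrib-+ n _ _)) (+-assoc _ _ _) ⟩
    ∑ n (λ i → ∑ (n ∸ i) (F i)) + (∑ n (λ i → F i (suc (n ∸ i))) + F (suc n) 0)
      ≈⟨ +-cong (∑-triangle n F)
                (+-cong (∑-cong n (λ i i≤n → reflexive (≡.cong (F i) (≡.sym (ℕₚ.+-∸-assoc 1 i≤n)))))
                        (reflexive (≡.cong (F (suc n)) (≡.sym (ℕₚ.n∸n≡0 n))))) ⟩
    ∑ (suc n) (λ k → ∑ k (λ i → F i (k ∸ i)))   ∎

module PowerSeries {c ℓ} (A : CommutativeRing c ℓ) where
  open CommutativeRing A
  open FiniteSum A
  open SetoidReasoning setoid
  open import Algebra.Properties.CommutativeSemigroup *-commutativeSemigroup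
    using (x∙yz≈y∙xz)
  open import Algebra.Structures using (IsCommutativeRing)

  Ser : Set c
  Ser = ℕ → Carrier

  infix  4 _≋_ _≋[_]_
  infixl 6 _⊕_
  infixl 7 _⊗_
  infixr 8 _^_

  _≋_ : Ser → Ser → Set ℓ
  F ≋ H = ∀ n → F n ≈ H n

  _⊕_ : Ser → Ser → Ser
  (F ⊕ H) n = F n + H n

  ⊝_ : Ser → Ser
  (⊝ F) n = - F n

  const : Carrier → Ser
  const r zero    = r
  const r (suc n) = 0#

  const-cong : ∀ {r s} → r ≈ s → const r ≋ const s
  const-cong r≈s zero    = r≈s
  const-cong r≈s (suc n) = refl

  const-+ : ∀ r s → const (r + s) ≋ const r ⊕ const s
  const-+ r s zero    = refl
  const-+ r s (suc n) = sym (+-identityʳ 0#)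

  𝟘 𝟙 𝕩 : Ser
  𝟘 n = 0#
  𝟙 = const 1#
  𝕩 (suc zero) = 1#
  𝕩 _          = 0#

  _⊗_ : Ser → Ser → Ser
  (F ⊗ H) n = ∑ n (λ i → F i * H (n ∸ i))

  ⊗-cong : ∀ {F F' H H'} → F ≋ F' → H ≋ H' → F ⊗ H ≋ F' ⊗ H'
  ⊗-cong F≋F' H≋H' n = ∑-cong n (λ i _ → *-cong (F≋F' i) (H≋H' (n ∸ i)))

  ⊕-cong : ∀ {F F' H H'} → F ≋ F' → H ≋ H' → F ⊕ H ≋ F' ⊕ H'
  ⊕-cong F≋F' H≋H' n = +-cong (F≋F' n) (H≋H' n)

  ⊕-congˡ : ∀ F {H H'} → H ≋ H' → F ⊕ H ≋ F ⊕ H'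
  ⊕-congˡ F H≋H' n = +-congˡ (H≋H' n)

  ⊕-congʳ : ∀ F {H H'} → H ≋ H' → H ⊕ F ≋ H' ⊕ F
  ⊕-congʳ F H≋H' n = +-congʳ (H≋H' n)

  ⊗-congˡ : ∀ F {H H'} → H ≋ H' → F ⊗ H ≋ F ⊗ H'
  ⊗-congˡ F H≋H' = ⊗-cong {F} {F} (λ n → refl) H≋H'

  ⊗-congʳ : ∀ F {H H'} → H ≋ H' → H ⊗ F ≋ H' ⊗ F
  ⊗-congʳ F H≋H' = ⊗-cong {H = F} {H' = F} H≋H' (λ n → refl)

  ⊗-comm : ∀ F H → F ⊗ H ≋ H ⊗ F
  ⊗-comm F H n = trans (∑-reverse n _)
    (∑-cong n (λ i i≤n → trans (*-comm _ _) (*-congʳ (reflexive (≡.cong H (ℕₚ.m∸[m∸n]≡n i≤n))))))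

  ⊗-assoc : ∀ F G H → (F ⊗ G) ⊗ H ≋ F ⊗ (G ⊗ H)
  ⊗-assoc F G H n = begin
    ∑ n (λ k → ∑ k (λ i → F i * G (k ∸ i)) * H (n ∸ k))
      ≈⟨ ∑-cong n (λ k _ → *-distribʳ-∑ k _ _) ⟩
    ∑ n (λ k → ∑ k (λ i → F i * G (k ∸ i) * H (n ∸ k)))
      ≈⟨ ∑-cong n (λ k _ → ∑-cong k (λ i i≤k → trans (*-assoc _ _ _)
           (*-congˡ (*-congˡ (reflexive (≡.cong H (≡.sym ([n∸i]∸[k∸i]≡n∸k n i≤k)))))))) ⟩
    ∑ n (λ k → ∑ k (λ i → F i * (G (k ∸ i) * H ((n ∸ i) ∸ (k ∸ i)))))
      ≈⟨ ∑-triangle n (λ i j → F i * (G j * H ((n ∸ i) ∸ j))) ⟨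
    ∑ n (λ i → ∑ (n ∸ i) (λ j → F i * (G j * H ((n ∸ i) ∸ j))))
      ≈⟨ ∑-cong n (λ i _ → *-distribˡ-∑ (n ∸ i) _ _) ⟨
    (F ⊗ (G ⊗ H)) n ∎

  ⊗-distribˡ-⊕ : ∀ F G H → F ⊗ (G ⊕ H) ≋ F ⊗ G ⊕ F ⊗ H
  ⊗-distribˡ-⊕ F G H n = trans (∑-cong n (λ i _ → distribˡ _ _ _)) (∑-distrib-+ n _ _)

  ⊗-distribʳ-⊕ : ∀ F G H → (G ⊕ H) ⊗ F ≋ G ⊗ F ⊕ H ⊗ F
  ⊗-distribʳ-⊕ F G H n = trans (∑-cong n (λ i _ → distribʳ _ _ _)) (∑-distrib-+ n _ _)

  const-⊗ : ∀ r F n → (const r ⊗ F) n ≈ r * F n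
  const-⊗ r F zero    = refl
  const-⊗ r F (suc n) = trans (∑-unfoldˡ n _) (trans (+-congˡ (∑-zero n (λ i _ → zeroˡ _))) (+-identityʳ _))

  ⊗-identityˡ : ∀ F → 𝟙 ⊗ F ≋ F
  ⊗-identityˡ F n = trans (const-⊗ 1# F n) (*-identityˡ (F n))

  ⊗-identityʳ : ∀ F → F ⊗ 𝟙 ≋ F
  ⊗-identityʳ F n = trans (⊗-comm F 𝟙 n) (⊗-identityˡ F n)

  ⊕-⊗-isCommutativeRing : IsCommutativeRing _≋_ _⊕_ _⊗_ ⊝_ 𝟘 𝟙
  ⊕-⊗-isCommutativeRing = record
    { isRing = record
      { +-isAbelianGroup = record
        { isGroup = record
          { isMonoid = record
            { isSemigroup = record
              { isMagma = record
                { isEquivalence = record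
                  { refl = λ n → refl ; sym = λ e n → sym (e n) ; trans = λ e e' n → trans (e n) (e' n) }
                ; ∙-cong = λ e e' n → +-cong (e n) (e' n) }
              ; assoc = λ F G H n → +-assoc (F n) (G n) (H n) }
            ; identity = (λ F n → +-identityˡ (F n)) , (λ F n → +-identityʳ (F n)) }
          ; inverse = (λ F n → -‿inverseˡ (F n)) , (λ F n → -‿inverseʳ (F n))
          ; ⁻¹-cong = λ e n → -‿cong (e n) }
        ; comm = λ F H n → +-comm (F n) (H n) }
      ; *-cong = ⊗-cong
      ; *-assoc = ⊗-assoc
      ; *-identity = ⊗-identityˡ , ⊗-identityʳ
      ; distrib = ⊗-distribˡ-⊕ , ⊗-distribʳ-⊕ }
    ; *-comm = ⊗-comm }

  commutativeRing : CommutativeRing c ℓ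
  commutativeRing = record { isCommutativeRing = ⊕-⊗-isCommutativeRing }

  open FiniteSum commutativeRing using () renaming (∑ to ∑ˢ)

  ∑ˢ-coeff : ∀ n (F : ℕ → Ser) m → ∑ˢ n F m ≡ ∑ n (λ i → F i m)
  ∑ˢ-coeff zero    F m = ≡.refl
  ∑ˢ-coeff (suc n) F m = ≡.cong (_+ F (suc n) m) (∑ˢ-coeff n F m)

  _^_ : Ser → ℕ → Ser
  Z ^ zero  = 𝟙
  Z ^ suc k = Z ⊗ Z ^ k

  ^-cong : ∀ {Z Z'} → Z ≋ Z' → ∀ k → Z ^ k ≋ Z' ^ k
  ^-cong Z≋Z' zero    = λ n → refl
  ^-cong Z≋Z' (suc k) = ⊗-cong Z≋Z' (^-cong Z≋Z' k)

  𝕩⊗-zero : ∀ F → (𝕩 ⊗ F) 0 ≈ 0#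
  𝕩⊗-zero F = zeroˡ (F 0)

  𝕩⊗-suc : ∀ F n → (𝕩 ⊗ F) (suc n) ≈ F n
  𝕩⊗-suc F n = begin
    (𝕩 ⊗ F) (suc n)              ≈⟨ ∑-unfoldˡ n _ ⟩
    0# * F (suc n) + ∑ n (λ i → 𝕩 (suc i) * F (n ∸ i))
                                 ≈⟨ +-cong (zeroˡ _) (∑-head n _ (λ i → zeroˡ _)) ⟩
    0# + 1# * F n                ≈⟨ trans (+-identityˡ _) (*-identityˡ _) ⟩
    F n                          ∎

  _≋[_]_ : Ser → ℕ → Ser → Set ℓ
  F ≋[ n ] H = ∀ r → r ℕ.< n → F r ≈ H r

  ≋[]-refl : ∀ {n} F → F ≋[ n ] F
  ≋[]-refl F r _ = refl

  ⊕-cong-≋[] : ∀ {n F F' H H'} → F ≋[ n ] F' → H ≋[ n ] H' → F ⊕ H ≋[ n ] F' ⊕ H'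
  ⊕-cong-≋[] F≋F' H≋H' r r<n = +-cong (F≋F' r r<n) (H≋H' r r<n)

  ⊗-cong-≋[] : ∀ {n F F' H H'} → F ≋[ n ] F' → H ≋[ n ] H' → F ⊗ H ≋[ n ] F' ⊗ H'
  ⊗-cong-≋[] F≋F' H≋H' r r<n = ∑-cong r (λ i i≤r →
    *-cong (F≋F' i (ℕₚ.≤-<-trans i≤r r<n)) (H≋H' (r ∸ i) (ℕₚ.≤-<-trans (ℕₚ.m∸n≤m r i) r<n)))

  ⊗-shift-≋[] : ∀ {n F H} Z → Z 0 ≈ 0# → F ≋[ n ] H → Z ⊗ F ≋[ suc n ] Z ⊗ H
  ⊗-shift-≋[] {n} {F} {H} Z Z₀≈0 F≋H r r<1+n = ∑-cong r (λ i i≤r → term r i r<1+n i≤r)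
    where
    term : ∀ r i → r ℕ.< suc n → i ℕ.≤ r → Z i * F (r ∸ i) ≈ Z i * H (r ∸ i)
    term r zero _ _ = trans (*-congʳ Z₀≈0) (trans (zeroˡ _) (sym (trans (*-congʳ Z₀≈0) (zeroˡ _))))
    term (suc r) (suc i) (s≤s r<n) (s≤s i≤r) = *-congˡ (F≋H (r ∸ i) (ℕₚ.≤-<-trans (ℕₚ.m∸n≤m r i) r<n))

  ⊗-zeroʳ : ∀ F → F ⊗ 𝟘 ≋ 𝟘
  ⊗-zeroʳ F n = ∑-zero n (λ i _ → zeroʳ _)

  ^-order : ∀ {Z} → Z 0 ≈ 0# → ∀ k → Z ^ k ≋[ k ] 𝟘
  ^-order Z₀≈0 zero    r ()
  ^-order {Z} Z₀≈0 (suc k) r r<1+k = trans (⊗-shift-≋[] Z Z₀≈0 (^-order Z₀≈0 k) r r<1+k) (⊗-zeroʳ Z r)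

  solution-unique : ∀ {b} {B : Set b} (σ : B → B) (K : B → Ser) {Z} → Z 0 ≈ 0# → {L L' : B → Ser} →
                    (∀ x → L x ≋ K x ⊕ Z ⊗ L (σ x)) → (∀ x → L' x ≋ K x ⊕ Z ⊗ L' (σ x)) →
                    ∀ x → L x ≋ L' x
  solution-unique σ K {Z} Z₀≈0 {L} {L'} L-eq L'-eq x n = agree (suc n) x n (ℕₚ.n<1+n n)
    where
    agree : ∀ m x → L x ≋[ m ] L' x
    agree zero    x r ()
    agree (suc m) x r r<1+m = trans (L-eq x r)
      (trans (+-congˡ (⊗-shift-≋[] Z Z₀≈0 (agree m (σ x)) r r<1+m)) (sym (L'-eq x r)))

  module Fixpoint (T : Ser → Ser) (T-contracts : ∀ {n F H} → F ≋[ n ] H → T F ≋[ suc n ] T H) where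

    approx : ℕ → Ser
    approx zero    = 𝟘
    approx (suc k) = T (approx k)

    -- the degree-n coefficient of the approximations is constant from the (n+1)-st one on
    fix : Ser
    fix n = approx (suc n) n

    approx-agree : ∀ k k' → approx k ≋[ k ⊓ k' ] approx k'
    approx-agree zero    k'       r ()
    approx-agree (suc k) zero     r ()
    approx-agree (suc k) (suc k') = T-contracts (approx-agree k k')

    fix-unfold : fix ≋ T fix
    fix-unfold n = T-contracts fix≋approx n (ℕₚ.n<1+n n)
      where
      fix≋approx : approx n ≋[ n ] fix
      fix≋approx r r<n = sym (approx-agree (suc r) n r (ℕₚ.⊓-glb (ℕₚ.n<1+n r) r<n))

    fix-induction : ∀ {p} (Q : Carrier → Set p) → Q 0# →
                    (∀ {F} → (∀ n → Q (F n)) → ∀ n → Q (T F n)) → ∀ n → Q (fix n)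
    fix-induction Q Q0 T-pres n = approx-pres (suc n) n
      where
      approx-pres : ∀ k n → Q (approx k n)
      approx-pres zero    n = Q0
      approx-pres (suc k) = T-pres (approx-pres k)

  -- b(Z) = Σₖ bₖ Zᵏ; for Z without constant term only k ≤ n contribute in degree n.
  compose : (ℕ → Carrier) → Ser → Ser
  compose b Z n = ∑ n (λ k → b k * (Z ^ k) n)

  compose-congˡ : ∀ {b b'} → (∀ k → b k ≈ b' k) → ∀ Z → compose b Z ≋ compose b' Z
  compose-congˡ b≈b' Z n = ∑-cong n (λ k _ → *-congʳ (b≈b' k))

  compose-congʳ : ∀ b {Z Z'} → Z ≋ Z' → compose b Z ≋ compose b Z'
  compose-congʳ b Z≋Z' n = ∑-cong n (λ k _ → *-congˡ (^-cong Z≋Z' k n))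

  compose-distrib-+ : ∀ b b' Z → compose (λ k → b k + b' k) Z ≋ compose b Z ⊕ compose b' Z
  compose-distrib-+ b b' Z n = trans (∑-cong n (λ k _ → distribʳ _ _ _)) (∑-distrib-+ n _ _)

  compose-extend : ∀ b {Z} → Z 0 ≈ 0# → ∀ {n} N → n ℕ.≤ N →
                   compose b Z n ≈ ∑ N (λ k → b k * (Z ^ k) n)
  compose-extend b Z₀≈0 N n≤N =
    sym (∑-extend N _ n≤N (λ k n<k → trans (*-congˡ (^-order Z₀≈0 k _ n<k)) (zeroʳ _)))

  compose-unfold : ∀ b {Z} → Z 0 ≈ 0# → compose b Z ≋ const (b 0) ⊕ Z ⊗ compose (b ∘ suc) Z
  compose-unfold b {Z} Z₀≈0 zero = trans (*-identityʳ (b 0))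
    (sym (trans (+-congˡ (trans (*-congʳ Z₀≈0) (zeroˡ _))) (+-identityʳ (b 0))))
  compose-unfold b {Z} Z₀≈0 (suc n) = begin
    compose b Z (suc n)
      ≈⟨ compose-extend b Z₀≈0 (suc (suc n)) (ℕₚ.n≤1+n (suc n)) ⟩
    ∑ (suc (suc n)) (λ k → b k * (Z ^ k) (suc n))
      ≈⟨ ∑-unfoldˡ (suc n) _ ⟩
    b 0 * 0# + ∑ (suc n) (λ k → b (suc k) * ∑ (suc n) (λ i → Z i * (Z ^ k) (suc n ∸ i)))
      ≈⟨ +-cong (zeroʳ (b 0)) (∑-cong (suc n) (λ k _ → *-distribˡ-∑ (suc n) _ _)) ⟩
    0# + ∑ (suc n) (λ k → ∑ (suc n) (λ i → b (suc k) * (Z i * (Z ^ k) (suc n ∸ i))))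
      ≈⟨ +-congˡ (∑-comm (suc n) (suc n) _) ⟩
    0# + ∑ (suc n) (λ i → ∑ (suc n) (λ k → b (suc k) * (Z i * (Z ^ k) (suc n ∸ i))))
      ≈⟨ +-congˡ (∑-cong (suc n) (λ i _ → ∑-cong (suc n) (λ k _ → x∙yz≈y∙xz _ _ _))) ⟩
    0# + ∑ (suc n) (λ i → ∑ (suc n) (λ k → Z i * (b (suc k) * (Z ^ k) (suc n ∸ i))))
      ≈⟨ +-congˡ (∑-cong (suc n) (λ i _ →
           trans (*-congˡ (compose-extend (b ∘ suc) Z₀≈0 (suc n) (ℕₚ.m∸n≤m (suc n) i)))
                 (*-distribˡ-∑ (suc n) _ _))) ⟨
    0# + (Z ⊗ compose (b ∘ suc) Z) (suc n) ∎

  𝕩-expansion : ∀ F → F ≋ const (F 0) ⊕ 𝕩 ⊗ (F ∘ suc)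
  𝕩-expansion F zero    = sym (trans (+-congˡ (𝕩⊗-zero (F ∘ suc))) (+-identityʳ (F 0)))
  𝕩-expansion F (suc n) = sym (trans (+-identityˡ _) (𝕩⊗-suc (F ∘ suc) n))

  compose-𝕩 : ∀ b → compose b 𝕩 ≋ b
  compose-𝕩 = solution-unique (_∘ suc) (λ b → const (b 0)) refl (λ b → compose-unfold b refl) 𝕩-expansion

  module Nonnegativity {p} (Nonneg : Carrier → Set p) (0⁺ : Nonneg 0#) (1⁺ : Nonneg 1#)
    (+⁺ : ∀ {x y} → Nonneg x → Nonneg y → Nonneg (x + y))
    (*⁺ : ∀ {x y} → Nonneg x → Nonneg y → Nonneg (x * y)) where

    Nonnegˢ : Ser → Set p
    Nonnegˢ F = ∀ n → Nonneg (F n)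

    ∑-nonneg : ∀ n {f} → (∀ i → Nonneg (f i)) → Nonneg (∑ n f)
    ∑-nonneg zero    f⁺ = f⁺ 0
    ∑-nonneg (suc n) f⁺ = +⁺ (∑-nonneg n f⁺) (f⁺ (suc n))

    const-nonneg : ∀ {r} → Nonneg r → Nonnegˢ (const r)
    const-nonneg r⁺ zero    = r⁺
    const-nonneg r⁺ (suc n) = 0⁺

    𝟘-nonneg : Nonnegˢ 𝟘
    𝟘-nonneg n = 0⁺

    𝟙-nonneg : Nonnegˢ 𝟙
    𝟙-nonneg = const-nonneg 1⁺

    𝕩-nonneg : Nonnegˢ 𝕩
    𝕩-nonneg zero          = 0⁺
    𝕩-nonneg (suc zero)    = 1⁺
    𝕩-nonneg (suc (suc n)) = 0⁺

    ⊕-nonneg : ∀ {F H} → Nonnegˢ F → Nonnegˢ H → Nonnegˢ (F ⊕ H)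
    ⊕-nonneg F⁺ H⁺ n = +⁺ (F⁺ n) (H⁺ n)

    ⊗-nonneg : ∀ {F H} → Nonnegˢ F → Nonnegˢ H → Nonnegˢ (F ⊗ H)
    ⊗-nonneg F⁺ H⁺ n = ∑-nonneg n (λ i → *⁺ (F⁺ i) (H⁺ (n ∸ i)))

    ^-nonneg : ∀ {Z} → Nonnegˢ Z → ∀ k → Nonnegˢ (Z ^ k)
    ^-nonneg Z⁺ zero    = 𝟙-nonneg
    ^-nonneg Z⁺ (suc k) = ⊗-nonneg Z⁺ (^-nonneg Z⁺ k)

    compose-nonneg : ∀ {b Z} → (∀ k → Nonneg (b k)) → Nonnegˢ Z → Nonnegˢ (compose b Z)
    compose-nonneg b⁺ Z⁺ n = ∑-nonneg n (λ k → *⁺ (b⁺ k) (^-nonneg Z⁺ k n))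

module OrderedCommRingProperties {c ℓ₁ ℓ₂} (R : OrderedCommRing c ℓ₁ ℓ₂) where
  open OrderedCommRing R
  open import Relation.Binary.Structures using (IsTotalOrder)
  open import Algebra.Properties.Ring ring using (-1*x≈-x; -‿involutive)
  open IsTotalOrder isTotalOrder using (total; ≤-respˡ-≈) renaming (trans to ≤-trans)
  open IsTotalOrder isTotalOrder public using (≤-respʳ-≈) renaming (refl to ≤-refl)

  +-nonneg : ∀ {x y} → 0# ≤ x → 0# ≤ y → 0# ≤ (x + y)
  +-nonneg {x} {y} 0≤x 0≤y = ≤-trans (≤-respʳ-≈ (sym (+-identityˡ y)) 0≤y) (+-mono-≤ y 0≤x)

  -- if 1 ≤ 0 then 0 ≤ -1, so 0 ≤ (-1)(-1) = 1
  0≤1 : 0# ≤ 1#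
  0≤1 with total 0# 1#
  ... | inj₁ 0≤1 = 0≤1
  ... | inj₂ 1≤0 = ≤-respʳ-≈ (trans (-1*x≈-x (- 1#)) (-‿involutive 1#)) (*-nonneg 0≤-1 0≤-1)
    where
    0≤-1 : 0# ≤ (- 1#)
    0≤-1 = ≤-respˡ-≈ (-‿inverseʳ 1#) (≤-respʳ-≈ (+-identityˡ (- 1#)) (+-mono-≤ (- 1#) 1≤0))

module CatalanInverse {c ℓ₁ ℓ₂} (R : OrderedCommRing c ℓ₁ ℓ₂) where
  open OrderedCommRing R
  open Series R
  open FiniteSum commutativeRing
  open SetoidReasoning setoid
  open import Algebra.Properties.CommutativeSemigroup +-commutativeSemigroup using (xy∙z≈y∙xz; xy∙z≈xz∙y)

  sumTo≡∑ : ∀ n f → sumTo n f ≡ ∑ n f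
  sumTo≡∑ zero    f = ≡.refl
  sumTo≡∑ (suc n) f = ≡.cong (_+ f (suc n)) (sumTo≡∑ n f)

  natR-+ : ∀ m n → natR (m ℕ.+ n) ≈ natR m + natR n
  natR-+ zero    n = sym (+-identityˡ (natR n))
  natR-+ (suc m) n = trans (+-congˡ (natR-+ m n)) (sym (+-assoc 1# (natR m) (natR n)))

  catInvEntry : ℕ → ℕ → Carrier
  catInvEntry i j = signR (j ∸ i) * natR (suc i C (j ∸ i))

  signed-pascal : ∀ m t → signR (suc t) * natR (suc m C suc t) + signR t * natR (m C t) ≈
                          signR (suc t) * natR (m C suc t)
  signed-pascal m t = begin
    - s * natR (suc m C suc t) + s * x
      ≈⟨ +-congʳ (*-congˡ (reflexive (≡.cong natR (≡.sym (nCk+nC[k+1]≡[n+1]C[k+1] m t))))) ⟩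
    - s * natR (m C t ℕ.+ m C suc t) + s * x
      ≈⟨ +-congʳ (trans (*-congˡ (natR-+ (m C t) (m C suc t))) (distribˡ (- s) x y)) ⟩
    - s * x + - s * y + s * x
      ≈⟨ xy∙z≈y∙xz (- s * x) (- s * y) (s * x) ⟩
    - s * y + (- s * x + s * x)
      ≈⟨ +-congˡ (trans (sym (distribʳ x (- s) s)) (trans (*-congʳ (-‿inverseˡ s)) (zeroˡ x))) ⟩
    - s * y + 0#
      ≈⟨ +-identityʳ (- s * y) ⟩
    - s * y ∎
    where
    s = signR t
    x = natR (m C t)
    y = natR (m C suc t)

  catInvEntry-pascal : ∀ {i j} → i ℕ.≤ j →
                       catInvEntry (suc i) (suc (suc j)) + catInvEntry i j ≈ catInvEntry i (suc j)
  catInvEntry-pascal {i} {j} i≤j rewrite ℕₚ.+-∸-assoc 1 i≤j = signed-pascal (suc i) (j ∸ i)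

  catInvEntry-diag : ∀ i → catInvEntry i i ≈ 1#
  catInvEntry-diag i rewrite ℕₚ.n∸n≡0 i = trans (*-identityˡ _) (+-identityʳ 1#)

  catInv-zero : ∀ a → catInv a 0 ≈ a 0
  catInv-zero a = trans (*-congˡ (catInvEntry-diag 0)) (*-identityʳ (a 0))

  catInv-one : ∀ a → catInv a 1 + a 0 ≈ catInv (a ∘ suc) 0
  catInv-one a = begin
    a 0 * catInvEntry 0 1 + a 1 * catInvEntry 1 1 + a 0  ≈⟨ xy∙z≈y∙xz _ _ (a 0) ⟩
    a 1 * catInvEntry 1 1 + (a 0 * catInvEntry 0 1 + a 0)
      ≈⟨ +-cong (*-congˡ (trans (catInvEntry-diag 1) (sym (catInvEntry-diag 0)))) a₀-cancels ⟩
    a 1 * catInvEntry 0 0 + 0#                           ≈⟨ +-identityʳ _ ⟩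
    a 1 * catInvEntry 0 0                                ∎
    where
    e₀₁+1≈0 : catInvEntry 0 1 + 1# ≈ 0#
    e₀₁+1≈0 = trans (+-congʳ (trans (*-congˡ (+-identityʳ 1#)) (*-identityʳ (- 1#)))) (-‿inverseˡ 1#)
    a₀-cancels : a 0 * catInvEntry 0 1 + a 0 ≈ 0#
    a₀-cancels = begin
      a 0 * catInvEntry 0 1 + a 0       ≈⟨ +-congˡ (*-identityʳ (a 0)) ⟨
      a 0 * catInvEntry 0 1 + a 0 * 1#  ≈⟨ distribˡ (a 0) _ 1# ⟨
      a 0 * (catInvEntry 0 1 + 1#)      ≈⟨ *-congˡ e₀₁+1≈0 ⟩
      a 0 * 0#                          ≈⟨ zeroʳ (a 0) ⟩
      0#                                ∎

  catInv-suc-suc : ∀ a j → catInv a (suc (suc j)) + catInv (a ∘ suc) j ≈ catInv (a ∘ suc) (suc j)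
  catInv-suc-suc a j = begin
    sumTo (suc (suc j)) f + sumTo j g
      ≈⟨ +-cong (reflexive (sumTo≡∑ (suc (suc j)) f)) (reflexive (sumTo≡∑ j g)) ⟩
    ∑ (suc (suc j)) f + ∑ j g               ≈⟨ +-congʳ (∑-unfoldˡ (suc j) f) ⟩
    f 0 + (∑ j (f ∘ suc) + f (suc (suc j))) + ∑ j g
                                            ≈⟨ trans (+-assoc _ _ _) (+-congˡ (xy∙z≈xz∙y _ _ _)) ⟩
    f 0 + (∑ j (f ∘ suc) + ∑ j g + f (suc (suc j)))
      ≈⟨ +-cong f₀≈0 (+-cong (trans (sym (∑-distrib-+ j (f ∘ suc) g)) (∑-cong j (λ i i≤j →
                                trans (sym (distribˡ (a (suc i)) _ _)) (*-congˡ (catInvEntry-pascal i≤j)))))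
                             (*-congˡ (trans (catInvEntry-diag (suc (suc j))) (sym (catInvEntry-diag (suc j)))))) ⟩
    0# + (∑ j h + h (suc j))                ≈⟨ +-identityˡ _ ⟩
    ∑ (suc j) h                             ≈⟨ reflexive (sumTo≡∑ (suc j) h) ⟨
    catInv (a ∘ suc) (suc j)                ∎
    where
    f g h : ℕ → Carrier
    f i = a i * catInvEntry i (suc (suc j))
    g i = a (suc i) * catInvEntry i j
    h i = a (suc i) * catInvEntry i (suc j)
    f₀≈0 : f 0 ≈ 0#
    f₀≈0 = trans (*-congˡ (zeroʳ _)) (zeroʳ (a 0))

module RunTransform {ℓ₀ ℓ₁ ℓ₂} (R : OrderedCommRing ℓ₀ ℓ₁ ℓ₂) where
  open OrderedCommRing R
  open Series R
  open FiniteSum commutativeRing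
  open CatalanInverse R
  module S₁ = PowerSeries commutativeRing
  module S₂ = PowerSeries S₁.commutativeRing
  open S₂ using (_≋_; _⊕_; _⊗_; 𝟙; 𝕩; _^_; const; compose)
  module R₁ = CommutativeRing S₁.commutativeRing
  module R₂ = CommutativeRing S₂.commutativeRing
  open import Algebra.Properties.Ring R₂.ring using (+-cancelʳ)
  open import Algebra.Properties.CommutativeSemigroup R₂.+-commutativeSemigroup using (xy∙z≈xz∙y)
  open import Algebra.Properties.CommutativeSemigroup R₂.*-commutativeSemigroup using (x∙yz≈y∙xz)
  open import Algebra.Solver.Ring.NaturalCoefficients.Default R₂.commutativeSemiring
    using (solve; _:=_; _:+_; _:*_)
  module ≋-Reasoning = SetoidReasoning R₂.setoid

  -- Series₂ is S₂.Ser: the outer index is the power of x, the inner one the power of y.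
  𝕪 : Series₂
  𝕪 = const S₁.𝕩

  ⟪_⟫ : Carrier → Series₂
  ⟪ r ⟫ = const (S₁.const r)

  ⊛≋⊗ : ∀ F H → F ⊛ H ≋ F ⊗ H
  ⊛≋⊗ F H n m = trans (reflexive (sumTo≡∑ n _))
    (trans (∑-cong n (λ i _ → reflexive (sumTo≡∑ m _))) (reflexive (≡.sym (S₁.∑ˢ-coeff n _ m))))

  oneS≋𝟙 : oneS ≋ 𝟙
  oneS≋𝟙 zero    zero    = refl
  oneS≋𝟙 zero    (suc m) = refl
  oneS≋𝟙 (suc n) m       = refl

  ^S≋^ : ∀ F k → F ^S k ≋ F ^ k
  ^S≋^ F zero    = oneS≋𝟙
  ^S≋^ F (suc k) = R₂.trans (⊛≋⊗ F (F ^S k)) (S₂.⊗-congˡ F (^S≋^ F k))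

  xS≋𝕩 : xS ≋ 𝕩
  xS≋𝕩 zero          m       = refl
  xS≋𝕩 (suc zero)    zero    = refl
  xS≋𝕩 (suc zero)    (suc m) = refl
  xS≋𝕩 (suc (suc n)) m       = refl

  1-x⊕x≋1 : oneMinusX ⊕ 𝕩 ≋ 𝟙
  1-x⊕x≋1 zero          zero    = +-identityʳ 1#
  1-x⊕x≋1 zero          (suc m) = +-identityʳ 0#
  1-x⊕x≋1 (suc zero)    zero    = -‿inverseˡ 1#
  1-x⊕x≋1 (suc zero)    (suc m) = +-identityʳ 0#
  1-x⊕x≋1 (suc (suc n)) m       = +-identityʳ 0#

  G P I : Series₂
  G = geomXY
  P = prefactor
  I = inner

  𝕩𝕪⊗-zero : ∀ F → (𝕩 ⊗ 𝕪 ⊗ F) 0 R₁.≈ R₁.0#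
  𝕩𝕪⊗-zero F = R₁.trans (S₂.⊗-assoc 𝕩 𝕪 F 0) (S₂.𝕩⊗-zero (𝕪 ⊗ F))

  𝕩𝕪⊗-suc : ∀ F n → (𝕩 ⊗ 𝕪 ⊗ F) (suc n) R₁.≈ S₁.𝕩 S₁.⊗ F n
  𝕩𝕪⊗-suc F n = R₁.trans (S₂.⊗-assoc 𝕩 𝕪 F (suc n)) (R₁.trans (S₂.𝕩⊗-suc (𝕪 ⊗ F) n) (S₂.const-⊗ S₁.𝕩 F n))

  G-unfold : G ≋ 𝟙 ⊕ 𝕩 ⊗ 𝕪 ⊗ G
  G-unfold zero    zero    = sym (trans (+-congˡ (𝕩𝕪⊗-zero G 0)) (+-identityʳ _))
  G-unfold zero    (suc m) = sym (trans (+-congˡ (𝕩𝕪⊗-zero G (suc m))) (+-identityʳ _))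
  G-unfold (suc n) zero    = sym (trans (+-congˡ (trans (𝕩𝕪⊗-suc G n 0) (S₁.𝕩⊗-zero (G n)))) (+-identityʳ _))
  G-unfold (suc n) (suc m) = sym (trans (+-identityˡ _) (trans (𝕩𝕪⊗-suc G n (suc m)) (S₁.𝕩⊗-suc (G n) m)))

  P⊕𝕩G≋G : P ⊕ 𝕩 ⊗ G ≋ G
  P⊕𝕩G≋G = begin
    P ⊕ 𝕩 ⊗ G              ≈⟨ S₂.⊕-cong (⊛≋⊗ oneMinusX G) (S₂.⊗-congʳ G (R₂.sym xS≋𝕩)) ⟩
    oneMinusX ⊗ G ⊕ xS ⊗ G ≈⟨ R₂.sym (R₂.distribʳ G oneMinusX xS) ⟩
    (oneMinusX ⊕ xS) ⊗ G   ≈⟨ S₂.⊗-congʳ G (R₂.trans (S₂.⊕-congˡ oneMinusX xS≋𝕩) 1-x⊕x≋1) ⟩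
    𝟙 ⊗ G                  ≈⟨ R₂.*-identityˡ G ⟩
    G                      ∎
    where open ≋-Reasoning

  I≋𝕩⊗P : I ≋ 𝕩 ⊗ P
  I≋𝕩⊗P = R₂.trans (⊛≋⊗ xS P) (S₂.⊗-congʳ P xS≋𝕩)

  G⊗G≋G⊕𝕩𝕪G² : G ⊗ G ≋ G ⊕ 𝕩 ⊗ 𝕪 ⊗ (G ⊗ G)
  G⊗G≋G⊕𝕩𝕪G² = begin
    G ⊗ G                           ≈⟨ S₂.⊗-congʳ G G-unfold ⟩
    (𝟙 ⊕ 𝕩 ⊗ 𝕪 ⊗ G) ⊗ G             ≈⟨ R₂.distribʳ G 𝟙 (𝕩 ⊗ 𝕪 ⊗ G) ⟩
    𝟙 ⊗ G ⊕ 𝕩 ⊗ 𝕪 ⊗ G ⊗ G           ≈⟨ S₂.⊕-cong (R₂.*-identityˡ G) (R₂.*-assoc (𝕩 ⊗ 𝕪) G G) ⟩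
    G ⊕ 𝕩 ⊗ 𝕪 ⊗ (G ⊗ G)             ∎
    where open ≋-Reasoning

  -- Writing V = G + D, the factorization P = V (1 - 𝕩V) becomes D = T D, since G² - G = 𝕩𝕪G².
  T-body T : Series₂ → Series₂
  T-body F = 𝕩 ⊗ 𝕪 ⊗ (G ⊗ G) ⊕ G ⊗ F ⊕ G ⊗ F ⊕ F ⊗ F
  T F      = 𝕩 ⊗ T-body F

  T-contracts : ∀ {n F H} → F S₂.≋[ n ] H → T F S₂.≋[ suc n ] T H
  T-contracts F≋H = S₂.⊗-shift-≋[] 𝕩 (λ m → refl)
    (S₂.⊕-cong-≋[] (S₂.⊕-cong-≋[] (S₂.⊕-cong-≋[] (S₂.≋[]-refl (𝕩 ⊗ 𝕪 ⊗ (G ⊗ G))) G⊗F≋G⊗H) G⊗F≋G⊗H)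
                   (S₂.⊗-cong-≋[] F≋H F≋H))
    where G⊗F≋G⊗H = S₂.⊗-cong-≋[] (S₂.≋[]-refl G) F≋H

  module DFix = S₂.Fixpoint T T-contracts

  D V W : Series₂
  D = DFix.fix
  V = G ⊕ D
  W = 𝕩 ⊗ V

  V⊕𝕩G≋G⊕WV : V ⊕ 𝕩 ⊗ G ≋ G ⊕ W ⊗ V
  V⊕𝕩G≋G⊕WV = begin
    G ⊕ D ⊕ 𝕩 ⊗ G                            ≈⟨ S₂.⊕-congʳ (𝕩 ⊗ G) (S₂.⊕-congˡ G DFix.fix-unfold) ⟩
    G ⊕ T D ⊕ 𝕩 ⊗ G                          ≈⟨ collect 𝕩 (𝕩 ⊗ 𝕪) G D (G ⊗ G) ⟩
    G ⊕ 𝕩 ⊗ (G ⊗ D ⊕ G ⊗ D ⊕ D ⊗ D ⊕ (G ⊕ 𝕩 ⊗ 𝕪 ⊗ (G ⊗ G)))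
                                             ≈⟨ S₂.⊕-congˡ G (S₂.⊗-congˡ 𝕩 (S₂.⊕-congˡ (G ⊗ D ⊕ G ⊗ D ⊕ D ⊗ D)
                                                  (R₂.sym G⊗G≋G⊕𝕩𝕪G²))) ⟩
    G ⊕ 𝕩 ⊗ (G ⊗ D ⊕ G ⊗ D ⊕ D ⊗ D ⊕ G ⊗ G) ≈⟨ square 𝕩 G D ⟩
    G ⊕ W ⊗ V                                ∎
    where
    open ≋-Reasoning
    collect = solve 5 (λ x q g d s → g :+ x :* (q :* s :+ g :* d :+ g :* d :+ d :* d) :+ x :* g
                                    := g :+ x :* (g :* d :+ g :* d :+ d :* d :+ (g :+ q :* s))) R₂.refl
    square = solve 3 (λ x g d → g :+ x :* (g :* d :+ g :* d :+ d :* d :+ g :* g)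
                              := g :+ x :* (g :+ d) :* (g :+ d)) R₂.refl

  V-unfold : V ≋ P ⊕ W ⊗ V
  V-unfold = +-cancelʳ (𝕩 ⊗ G) V (P ⊕ W ⊗ V) (begin
    V ⊕ 𝕩 ⊗ G           ≈⟨ V⊕𝕩G≋G⊕WV ⟩
    G ⊕ W ⊗ V           ≈⟨ S₂.⊕-congʳ (W ⊗ V) (R₂.sym P⊕𝕩G≋G) ⟩
    P ⊕ 𝕩 ⊗ G ⊕ W ⊗ V   ≈⟨ xy∙z≈xz∙y P (𝕩 ⊗ G) (W ⊗ V) ⟩
    P ⊕ W ⊗ V ⊕ 𝕩 ⊗ G   ∎)
    where open ≋-Reasoning

  I⊕W²≋W : I ⊕ W ⊗ W ≋ W
  I⊕W²≋W = begin
    I ⊕ W ⊗ W               ≈⟨ S₂.⊕-cong I≋𝕩⊗P (x∙yz≈y∙xz W 𝕩 V) ⟩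
    𝕩 ⊗ P ⊕ 𝕩 ⊗ (W ⊗ V)     ≈⟨ R₂.distribˡ 𝕩 P (W ⊗ V) ⟨
    𝕩 ⊗ (P ⊕ W ⊗ V)         ≈⟨ S₂.⊗-congˡ 𝕩 V-unfold ⟨
    W                       ∎
    where open ≋-Reasoning

  eval : (ℕ → Carrier) → Series₂ → Series₂
  eval b = compose (S₁.const ∘ b)

  eval-unfold : ∀ b {Z} → Z 0 R₁.≈ R₁.0# → eval b Z ≋ ⟪ b 0 ⟫ ⊕ Z ⊗ eval (b ∘ suc) Z
  eval-unfold b = S₂.compose-unfold (S₁.const ∘ b)

  eval-congˡ : ∀ {b b'} → (∀ k → b k ≈ b' k) → ∀ Z → eval b Z ≋ eval b' Z
  eval-congˡ b≈b' = S₂.compose-congˡ (λ k → S₁.const-cong (b≈b' k))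

  eval-+ : ∀ b b' Z → eval (λ k → b k + b' k) Z ≋ eval b Z ⊕ eval b' Z
  eval-+ b b' Z = R₂.trans (S₂.compose-congˡ (λ k → S₁.const-+ (b k) (b' k)) Z)
                           (S₂.compose-distrib-+ (S₁.const ∘ b) (S₁.const ∘ b') Z)

  ⟪⟫-cong : ∀ {r s} → r ≈ s → ⟪ r ⟫ ≋ ⟪ s ⟫
  ⟪⟫-cong r≈s = S₂.const-cong (S₁.const-cong r≈s)

  ⟪⟫-+ : ∀ r s → ⟪ r + s ⟫ ≋ ⟪ r ⟫ ⊕ ⟪ s ⟫
  ⟪⟫-+ r s = R₂.trans (S₂.const-cong (S₁.const-+ r s)) (S₂.const-+ (S₁.const r) (S₁.const s))

  W₀≈0 : W 0 R₁.≈ R₁.0#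
  W₀≈0 = S₂.𝕩⊗-zero V

  I₀≈0 : I 0 R₁.≈ R₁.0#
  I₀≈0 = R₁.trans (I≋𝕩⊗P 0) (S₂.𝕩⊗-zero P)

  -- Adding W²·c'(W) to both sides, the claim follows from I + W² = W and the recurrences of catInv.
  catInv-inversion : ∀ a → eval (catInv a) W ⊕ W ⊗ ⟪ a 0 ⟫ ≋ ⟪ a 0 ⟫ ⊕ I ⊗ eval (catInv (a ∘ suc)) W
  catInv-inversion a = +-cancelʳ (W ⊗ W ⊗ E') _ _ (begin
    eval c W ⊕ W ⊗ ⟪ a 0 ⟫ ⊕ W ⊗ W ⊗ E'
      ≈⟨ S₂.⊕-congʳ (W ⊗ W ⊗ E') (S₂.⊕-congʳ (W ⊗ ⟪ a 0 ⟫) c-unfold) ⟩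
    ⟪ a 0 ⟫ ⊕ W ⊗ (⟪ c 1 ⟫ ⊕ W ⊗ E₂) ⊕ W ⊗ ⟪ a 0 ⟫ ⊕ W ⊗ W ⊗ E'
      ≈⟨ regroup ⟪ a 0 ⟫ W ⟪ c 1 ⟫ E₂ E' ⟩
    ⟪ a 0 ⟫ ⊕ W ⊗ (⟪ c 1 ⟫ ⊕ ⟪ a 0 ⟫) ⊕ W ⊗ W ⊗ (E₂ ⊕ E')
      ≈⟨ S₂.⊕-cong (S₂.⊕-congˡ ⟪ a 0 ⟫ (S₂.⊗-congˡ W c₁-rec)) (S₂.⊗-congˡ (W ⊗ W) tail-rec) ⟩
    ⟪ a 0 ⟫ ⊕ W ⊗ ⟪ c' 0 ⟫ ⊕ W ⊗ W ⊗ E''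
      ≈⟨ factor ⟪ a 0 ⟫ W ⟪ c' 0 ⟫ E'' ⟩
    ⟪ a 0 ⟫ ⊕ W ⊗ (⟪ c' 0 ⟫ ⊕ W ⊗ E'')
      ≈⟨ S₂.⊕-congˡ ⟪ a 0 ⟫ (S₂.⊗-congˡ W (eval-unfold c' W₀≈0)) ⟨
    ⟪ a 0 ⟫ ⊕ W ⊗ E'
      ≈⟨ S₂.⊕-congˡ ⟪ a 0 ⟫ (S₂.⊗-congʳ E' I⊕W²≋W) ⟨
    ⟪ a 0 ⟫ ⊕ (I ⊕ W ⊗ W) ⊗ E'
      ≈⟨ expand ⟪ a 0 ⟫ I W E' ⟩
    ⟪ a 0 ⟫ ⊕ I ⊗ E' ⊕ W ⊗ W ⊗ E' ∎)
    where
    open ≋-Reasoning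
    c c' : ℕ → Carrier
    c  = catInv a
    c' = catInv (a ∘ suc)
    E₂ E' E'' : Series₂
    E₂  = eval (c ∘ suc ∘ suc) W
    E'  = eval c' W
    E'' = eval (c' ∘ suc) W
    c-unfold : eval c W ≋ ⟪ a 0 ⟫ ⊕ W ⊗ (⟪ c 1 ⟫ ⊕ W ⊗ E₂)
    c-unfold = R₂.trans (eval-unfold c W₀≈0)
      (S₂.⊕-cong (⟪⟫-cong (catInv-zero a)) (S₂.⊗-congˡ W (eval-unfold (c ∘ suc) W₀≈0)))
    c₁-rec : ⟪ c 1 ⟫ ⊕ ⟪ a 0 ⟫ ≋ ⟪ c' 0 ⟫
    c₁-rec = R₂.trans (R₂.sym (⟪⟫-+ (c 1) (a 0))) (⟪⟫-cong (catInv-one a))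
    tail-rec : E₂ ⊕ E' ≋ E''
    tail-rec = R₂.trans (R₂.sym (eval-+ (c ∘ suc ∘ suc) c' W)) (eval-congˡ (catInv-suc-suc a) W)
    regroup = solve 5 (λ a w c₁ e₂ e' → a :+ w :* (c₁ :+ w :* e₂) :+ w :* a :+ w :* w :* e'
                                      := a :+ w :* (c₁ :+ a) :+ w :* w :* (e₂ :+ e')) R₂.refl
    factor  = solve 4 (λ a w k e'' → a :+ w :* k :+ w :* w :* e'' := a :+ w :* (k :+ w :* e'')) R₂.refl
    expand  = solve 4 (λ a i w e' → a :+ (i :+ w :* w) :* e' := a :+ i :* e' :+ w :* w :* e') R₂.refl

  -- (1 - W) a(I) = c(W), stated without subtraction
  eval-inversion : ∀ a → eval a I ≋ eval (catInv a) W ⊕ W ⊗ eval a I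
  eval-inversion = S₂.solution-unique (_∘ suc) (λ a → ⟪ a 0 ⟫) I₀≈0 (λ a → eval-unfold a I₀≈0) rhs-unfold
    where
    rhs-unfold : ∀ a → eval (catInv a) W ⊕ W ⊗ eval a I ≋
                       ⟪ a 0 ⟫ ⊕ I ⊗ (eval (catInv (a ∘ suc)) W ⊕ W ⊗ eval (a ∘ suc) I)
    rhs-unfold a = begin
      E ⊕ W ⊗ eval a I                  ≈⟨ S₂.⊕-congˡ E (S₂.⊗-congˡ W (eval-unfold a I₀≈0)) ⟩
      E ⊕ W ⊗ (⟪ a 0 ⟫ ⊕ I ⊗ S')        ≈⟨ shuffle E W ⟪ a 0 ⟫ I S' ⟩
      E ⊕ W ⊗ ⟪ a 0 ⟫ ⊕ I ⊗ (W ⊗ S')    ≈⟨ S₂.⊕-congʳ (I ⊗ (W ⊗ S')) (catInv-inversion a) ⟩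
      ⟪ a 0 ⟫ ⊕ I ⊗ E' ⊕ I ⊗ (W ⊗ S')   ≈⟨ R₂.trans (R₂.+-assoc ⟪ a 0 ⟫ (I ⊗ E') (I ⊗ (W ⊗ S')))
                                              (S₂.⊕-congˡ ⟪ a 0 ⟫ (R₂.sym (R₂.distribˡ I E' (W ⊗ S')))) ⟩
      ⟪ a 0 ⟫ ⊕ I ⊗ (E' ⊕ W ⊗ S')       ∎
      where
      E E' S' : Series₂
      E  = eval (catInv a) W
      E' = eval (catInv (a ∘ suc)) W
      S' = eval (a ∘ suc) I
      open ≋-Reasoning
      shuffle = solve 5 (λ e w a i s → e :+ w :* (a :+ i :* s) := e :+ w :* a :+ i :* (w :* s)) R₂.refl

  Φ≋P⊗eval : ∀ a → Φ a ≋ P ⊗ eval a I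
  Φ≋P⊗eval a = R₂.trans (⊛≋⊗ P composite) (S₂.⊗-congˡ P composite≋eval)
    where
    composite : Series₂
    composite n m = sumTo n (λ k → a k * (inner ^S k) n m)
    composite≋eval : composite ≋ eval a I
    composite≋eval n m = trans (reflexive (sumTo≡∑ n _))
      (trans (∑-cong n (λ k _ → trans (*-congˡ (^S≋^ inner k n m)) (sym (S₁.const-⊗ (a k) ((I ^ k) n) m))))
             (reflexive (≡.sym (S₁.∑ˢ-coeff n _ m))))

  Φ-factorization : ∀ a → Φ a ≋ V ⊗ eval (catInv a) W
  Φ-factorization a = R₂.trans (Φ≋P⊗eval a) (+-cancelʳ (W ⊗ V ⊗ S) (P ⊗ S) (V ⊗ E) (begin
    P ⊗ S ⊕ W ⊗ V ⊗ S    ≈⟨ R₂.distribʳ S P (W ⊗ V) ⟨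
    (P ⊕ W ⊗ V) ⊗ S      ≈⟨ S₂.⊗-congʳ S V-unfold ⟨
    V ⊗ S                ≈⟨ S₂.⊗-congˡ V (eval-inversion a) ⟩
    V ⊗ (E ⊕ W ⊗ S)      ≈⟨ distribute V E W S ⟩
    V ⊗ E ⊕ W ⊗ V ⊗ S    ∎))
    where
    open ≋-Reasoning
    S E : Series₂
    S = eval a I
    E = eval (catInv a) W
    distribute = solve 4 (λ v e w s → v :* (e :+ w :* s) := v :* e :+ w :* v :* s) R₂.refl

  atY0 : Series₂ → S₁.Ser
  atY0 F n = F n 0

  atY0-⊗ : ∀ F H → atY0 (F ⊗ H) S₁.≋ atY0 F S₁.⊗ atY0 H
  atY0-⊗ F H n = reflexive (S₁.∑ˢ-coeff n _ 0)

  atY0-^ : ∀ Z k → atY0 (Z ^ k) S₁.≋ atY0 Z S₁.^ k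
  atY0-^ Z zero    zero    = refl
  atY0-^ Z zero    (suc n) = refl
  atY0-^ Z (suc k) = R₁.trans (atY0-⊗ Z (Z ^ k)) (S₁.⊗-congˡ (atY0 Z) (atY0-^ Z k))

  atY0-eval : ∀ b Z → atY0 (eval b Z) S₁.≋ S₁.compose b (atY0 Z)
  atY0-eval b Z n = trans (reflexive (S₁.∑ˢ-coeff n _ 0)) (∑-cong n (λ k _ → *-congˡ (atY0-^ Z k n)))

  atY0-𝕩 : atY0 𝕩 S₁.≋ S₁.𝕩
  atY0-𝕩 zero          = refl
  atY0-𝕩 (suc zero)    = refl
  atY0-𝕩 (suc (suc n)) = refl

  atY0-G : atY0 G S₁.≋ S₁.𝟙
  atY0-G zero    = refl
  atY0-G (suc n) = refl

  VanishesAtY0 : Series₂ → Set ℓ₁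
  VanishesAtY0 F = atY0 F S₁.≋ S₁.𝟘

  ⊗-vanishesˡ : ∀ F H → VanishesAtY0 F → VanishesAtY0 (F ⊗ H)
  ⊗-vanishesˡ F H F₀ = R₁.trans (atY0-⊗ F H) (R₁.trans (S₁.⊗-congʳ (atY0 H) F₀) (R₁.zeroˡ (atY0 H)))

  ⊗-vanishesʳ : ∀ F H → VanishesAtY0 H → VanishesAtY0 (F ⊗ H)
  ⊗-vanishesʳ F H H₀ = R₁.trans (atY0-⊗ F H) (R₁.trans (S₁.⊗-congˡ (atY0 F) H₀) (R₁.zeroʳ (atY0 F)))

  ⊕-vanishes : ∀ F H → VanishesAtY0 F → VanishesAtY0 H → VanishesAtY0 (F ⊕ H)
  ⊕-vanishes F H F₀ H₀ n = trans (+-cong (F₀ n) (H₀ n)) (+-identityʳ 0#)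

  D-vanishes : VanishesAtY0 D
  D-vanishes = DFix.fix-induction (λ F → F 0 ≈ 0#) refl
                 (λ {F} F₀ → ⊗-vanishesʳ 𝕩 (T-body F) (T-body-vanishes F F₀))
    where
    𝕪-vanishes : VanishesAtY0 𝕪
    𝕪-vanishes zero    = refl
    𝕪-vanishes (suc n) = refl
    T-body-vanishes : ∀ F → VanishesAtY0 F → VanishesAtY0 (T-body F)
    T-body-vanishes F F₀ =
      ⊕-vanishes (𝕩 ⊗ 𝕪 ⊗ (G ⊗ G) ⊕ G ⊗ F ⊕ G ⊗ F) (F ⊗ F)
        (⊕-vanishes (𝕩 ⊗ 𝕪 ⊗ (G ⊗ G) ⊕ G ⊗ F) (G ⊗ F)
          (⊕-vanishes (𝕩 ⊗ 𝕪 ⊗ (G ⊗ G)) (G ⊗ F)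
            (⊗-vanishesˡ (𝕩 ⊗ 𝕪) (G ⊗ G) (⊗-vanishesʳ 𝕩 𝕪 𝕪-vanishes))
            (⊗-vanishesʳ G F F₀))
          (⊗-vanishesʳ G F F₀))
        (⊗-vanishesʳ F F F₀)

  atY0-V : atY0 V S₁.≋ S₁.𝟙
  atY0-V n = trans (+-congˡ (D-vanishes n)) (trans (+-identityʳ _) (atY0-G n))

  atY0-W : atY0 W S₁.≋ S₁.𝕩
  atY0-W = R₁.trans (atY0-⊗ 𝕩 V) (R₁.trans (S₁.⊗-cong atY0-𝕩 atY0-V) (S₁.⊗-identityʳ S₁.𝕩))

  Φ-at-y0 : ∀ a j → Φ a j 0 ≈ catInv a j
  Φ-at-y0 a j = begin
    Φ a j 0                                           ≈⟨ Φ-factorization a j 0 ⟩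
    atY0 (V ⊗ eval (catInv a) W) j                    ≈⟨ atY0-⊗ V (eval (catInv a) W) j ⟩
    (atY0 V S₁.⊗ atY0 (eval (catInv a) W)) j
      ≈⟨ S₁.⊗-cong atY0-V (R₁.trans (atY0-eval (catInv a) W) (S₁.compose-congʳ (catInv a) atY0-W)) j ⟩
    (S₁.𝟙 S₁.⊗ S₁.compose (catInv a) S₁.𝕩) j          ≈⟨ S₁.⊗-identityˡ (S₁.compose (catInv a) S₁.𝕩) j ⟩
    S₁.compose (catInv a) S₁.𝕩 j                      ≈⟨ S₁.compose-𝕩 (catInv a) j ⟩
    catInv a j                                        ∎
    where open SetoidReasoning setoid

  open OrderedCommRingProperties R
  module N₁ = S₁.Nonnegativity (0# ≤_) ≤-refl 0≤1 +-nonneg *-nonneg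
  module N₂ = S₂.Nonnegativity N₁.Nonnegˢ N₁.𝟘-nonneg N₁.𝟙-nonneg N₁.⊕-nonneg N₁.⊗-nonneg
  open N₂ using (Nonnegˢ; ⊕-nonneg; ⊗-nonneg)

  G-nonneg : Nonnegˢ G
  G-nonneg zero    zero    = 0≤1
  G-nonneg zero    (suc m) = ≤-refl
  G-nonneg (suc n) zero    = ≤-refl
  G-nonneg (suc n) (suc m) = G-nonneg n m

  D-nonneg : Nonnegˢ D
  D-nonneg = DFix.fix-induction N₁.Nonnegˢ N₁.𝟘-nonneg (λ F⁺ → ⊗-nonneg 𝕩⁺ (T-body-nonneg F⁺))
    where
    𝕩⁺ = N₂.𝕩-nonneg
    T-body-nonneg : ∀ {F} → Nonnegˢ F → Nonnegˢ (T-body F)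
    T-body-nonneg F⁺ = ⊕-nonneg (⊕-nonneg (⊕-nonneg
      (⊗-nonneg (⊗-nonneg 𝕩⁺ (N₂.const-nonneg N₁.𝕩-nonneg)) (⊗-nonneg G-nonneg G-nonneg))
      (⊗-nonneg G-nonneg F⁺)) (⊗-nonneg G-nonneg F⁺)) (⊗-nonneg F⁺ F⁺)

  V-nonneg : Nonnegˢ V
  V-nonneg = ⊕-nonneg G-nonneg D-nonneg

  W-nonneg : Nonnegˢ W
  W-nonneg = ⊗-nonneg N₂.𝕩-nonneg V-nonneg

  Φ-nonneg : ∀ a → (∀ j → 0# ≤ catInv a j) → ∀ n m → 0# ≤ Φ a n m
  Φ-nonneg a c⁺ n m = ≤-respʳ-≈ (sym (Φ-factorization a n m))
    (⊗-nonneg V-nonneg (N₂.compose-nonneg (λ k → N₁.const-nonneg (c⁺ k)) W-nonneg) n m)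

  catInv-nonneg : ∀ a → (∀ n m → 0# ≤ Φ a n m) → ∀ j → 0# ≤ catInv a j
  catInv-nonneg a Φ⁺ j = ≤-respʳ-≈ (Φ-at-y0 a j) (Φ⁺ j 0)

proposition3 : ∀ {c ℓ₁ ℓ₂} (R : OrderedCommRing c ℓ₁ ℓ₂) →
    let open OrderedCommRing R
        open Series R
    in (a : ℕ → Carrier) → (∀ k → 0# ≤ a k) →
       ((∀ n m → 0# ≤ Φ a n m) ⇔ (∀ j → 0# ≤ catInv a j))
proposition3 R a _ = mk⇔ (catInv-nonneg a) (Φ-nonneg a)
  where open RunTransform R
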